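{- Fix $n\ge1$ and distinct propositional variables $p_{i,j}$ ($1\le i\le n+1$, $1\le j\le n$). Let $\vec Q$ be the list $p_{1,1},\dots,p_{n+1,1},p_{1,2},\dots,p_{n+1,2},\dots,p_{1,n},\dots,p_{n+1,n}$. Then there are $\mathsf{posELNDT}$ proofs over the extension axioms $\mathcal T$, of size polynomial in $n$, of the sequent $t^{\vec Q}_{n+1}\ \to\ \bigvee_{j=1}^n\bigvee_{i=1}^n\bigvee_{i'=i+1}^{n+1}\mathrm{pd}(0,p_{i,j},p_{i',j})$.
   Context: eNDT formulas: built from propositional variables, constants $0,1$ and extension variables by $\vee$ and decisions $\mathrm{dec}(A,p,B)$ ("if $p$ then $B$ else $A$", $p$ a propositional variable). $\mathrm{pd}(A,p,C):=\mathrm{dec}(A,p,A\vee C)$; positive formulas have only decisions of this form. An extension axiom $e\leftrightarrow A$ stands for sequents $e\to A$ and $A\to e$. Threshold axioms $\mathcal T$: for every list $\vec p$ of propositional variables and integer $k$, an extension variable $t^{\vec p}_k$, with axioms $t^{\epsilon}_0\leftrightarrow1$, $t^{\epsilon}_k\leftrightarrow0$ ($k\ne0$), $t^{p\vec p}_k\leftrightarrow\mathrm{pd}(t^{\vec p}_k,p,t^{\vec p}_{k-1})$ ($\epsilon$ empty list; $p\vec p$ = $\vec p$ with $p$ prepended). $\mathsf{posELNDT}$: sequents on multisets; initial sequents $0\to$, $\to1$, $p\to p$; cut; left/right weakening and contraction; $\vee$-left (from $\Gamma,A\to\Delta$ and $\Gamma,B\to\Delta$ infer $\Gamma,A\vee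 B\to\Delta$); $\vee$-right (from $\Gamma\to\Delta,A,B$ infer $\Gamma\to\Delta,A\vee B$); positive decision left (from $\Gamma,A\to\Delta$ and $\Gamma,p,B\to\Delta$ infer $\Gamma,\mathrm{pd}(A,p,B)\to\Delta$) and right (from $\Gamma\to\Delta,A,p$ and $\Gamma\to\Delta,A,B$ infer $\Gamma\to\Delta,\mathrm{pd}(A,p,B)$); all formulas positive. A proof over a set of extension axioms: finite list of sequents, each an axiom sequent or derived by a rule (conclusion may contain extension variables). Size = number of symbols. -}

module Defs where

open import Data.Nat using (ℕ; zero; suc; _+_; _*_; _≤_; _<_; _∸_)
open import Data.Integer as ℤ using (ℤ)
open import Data.List using (List; []; _∷_; map; upTo; concatMap)
open import Data.Nat.ListAction using (sum)
open import Data.List.Membership.Propositional using (_∈_)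
open import Data.List.Relation.Binary.Permutation.Propositional using (_↭_)
open import Data.Product using (Σ; _×_; _,_)
open import Relation.Binary.PropositionalEquality using (_≡_; _≢_)

-- Extension variables are the threshold variables t^{ps}_k (the only
-- extension variables occurring in the axioms 𝒯).
-- Since all formulas in posELNDT are positive, decisions only occur in
-- the form  pd(A,p,C) := dec(A,p,A ∨ C);  the constructor `pd` below
-- represents exactly the eNDT formula dec(A,p,A ∨ C).

data Fm : Set where
  var : ℕ → Fm
  𝟘 𝟙 : Fm
  ext : List ℕ → ℤ → Fm
  _∨_ : Fm → Fm → Fm
  pd  : Fm → ℕ → Fm → Fm

-- number of symbols (pd A p C is counted as the formula dec(A,p,A∨C),
-- so A is counted twice)
size : Fm → ℕ
size (var _)   = 1
size 𝟘         = 1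
size 𝟙         = 1
size (ext _ _) = 1
size (A ∨ B)   = size A + size B + 1
size (pd A p C) = 1 + size A + 1 + (size A + size C + 1)

-- Sequents on multisets (lists up to permutation).

record Seq : Set where
  constructor _⇒_
  field
    ant : List Fm
    succ : List Fm
open Seq public

_≈S_ : Seq → Seq → Set
(Γ ⇒ Δ) ≈S (Γ' ⇒ Δ') = (Γ ↭ Γ') × (Δ ↭ Δ')

sizeSeq : Seq → ℕ
sizeSeq (Γ ⇒ Δ) = sum (map size Γ) + sum (map size Δ) + 1

_∈≈_ : Seq → List Seq → Set
S ∈≈ L = Σ Seq λ S' → (S' ∈ L) × (S' ≈S S)

data ThrDef : Fm → Fm → Set where
  t-nil0 : ThrDef (ext [] (ℤ.+ 0)) 𝟙
  t-nilk : ∀ k → k ≢ ℤ.+ 0 → ThrDef (ext [] k) 𝟘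
  t-cons : ∀ p ps k →
    ThrDef (ext (p ∷ ps) k) (pd (ext ps k) p (ext ps (k ℤ.- ℤ.+ 1)))

data 𝒯 : Seq → Set where
  ax→ : ∀ {e A} → ThrDef e A → 𝒯 ((e ∷ []) ⇒ (A ∷ []))
  ax← : ∀ {e A} → ThrDef e A → 𝒯 ((A ∷ []) ⇒ (e ∷ []))

-- One inference step of posELNDT whose premises occur (up to multiset
-- equality) in the list L of earlier sequents.  Γ,A is written A ∷ Γ.

data Step (L : List Seq) : Seq → Set where
  init0 : Step L ((𝟘 ∷ []) ⇒ [])
  init1 : Step L ([] ⇒ (𝟙 ∷ []))
  initp : ∀ p → Step L ((var p ∷ []) ⇒ (var p ∷ []))
  cut   : ∀ {Γ Δ A} → (Γ ⇒ (A ∷ Δ)) ∈≈ L → ((A ∷ Γ) ⇒ Δ) ∈≈ L → Step L (Γ ⇒ Δ)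
  wkL   : ∀ {Γ Δ A} → (Γ ⇒ Δ) ∈≈ L → Step L ((A ∷ Γ) ⇒ Δ)
  wkR   : ∀ {Γ Δ A} → (Γ ⇒ Δ) ∈≈ L → Step L (Γ ⇒ (A ∷ Δ))
  ctrL  : ∀ {Γ Δ A} → ((A ∷ A ∷ Γ) ⇒ Δ) ∈≈ L → Step L ((A ∷ Γ) ⇒ Δ)
  ctrR  : ∀ {Γ Δ A} → (Γ ⇒ (A ∷ A ∷ Δ)) ∈≈ L → Step L (Γ ⇒ (A ∷ Δ))
  ∨L    : ∀ {Γ Δ A B} → ((A ∷ Γ) ⇒ Δ) ∈≈ L → ((B ∷ Γ) ⇒ Δ) ∈≈ L →
          Step L (((A ∨ B) ∷ Γ) ⇒ Δ)
  ∨R    : ∀ {Γ Δ A B} → (Γ ⇒ (A ∷ B ∷ Δ)) ∈≈ L → Step L (Γ ⇒ ((A ∨ B) ∷ Δ))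
  pdL   : ∀ {Γ Δ A p B} → ((A ∷ Γ) ⇒ Δ) ∈≈ L → ((var p ∷ B ∷ Γ) ⇒ Δ) ∈≈ L →
          Step L ((pd A p B ∷ Γ) ⇒ Δ)
  pdR   : ∀ {Γ Δ A p B} → (Γ ⇒ (A ∷ var p ∷ Δ)) ∈≈ L → (Γ ⇒ (A ∷ B ∷ Δ)) ∈≈ L →
          Step L (Γ ⇒ (pd A p B ∷ Δ))

-- A proof over extension axioms Ax: a list of sequents (stored with the
-- LAST sequent first), each an axiom or derived by a rule from earlier ones
-- (the written sequent may differ from the rule's conclusion by reordering
-- of the multisets).
data IsProof (Ax : Seq → Set) : List Seq → Set where
  []    : IsProof Ax []
  axiom : ∀ {S L} → Ax S → IsProof Ax L → IsProof Ax (S ∷ L)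
  rule  : ∀ {S S' L} → Step L S' → S ≈S S' → IsProof Ax L → IsProof Ax (S ∷ L)

proofSize : List Seq → ℕ
proofSize L = sum (map sizeSeq L)

range : ℕ → ℕ → List ℕ
range a b = map (a +_) (upTo (suc b ∸ a))

-- right-nested disjunction of a list (the lists used are nonempty)
⋁ : List Fm → Fm
⋁ []           = 𝟘
⋁ (A ∷ [])     = A
⋁ (A ∷ B ∷ As) = A ∨ ⋁ (B ∷ As)

Qlist : ℕ → (ℕ → ℕ → ℕ) → List ℕ
Qlist n v = concatMap (λ j → map (λ i → v i j) (range 1 (suc n))) (range 1 n)

PHPdisj : ℕ → (ℕ → ℕ → ℕ) → Fm
PHPdisj n v =
  ⋁ (map (λ j → ⋁ (map (λ i → ⋁ (map (λ i' → pd 𝟘 (v i j) (var (v i' j)))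
                                      (range (suc i) (suc n))))
                       (range 1 n)))
         (range 1 n))

target : ℕ → (ℕ → ℕ → ℕ) → Seq
target n v = (ext (Qlist n v) (ℤ.+ (suc n)) ∷ []) ⇒ (PHPdisj n v ∷ [])

Distinct : ℕ → (ℕ → ℕ → ℕ) → Set
Distinct n v = ∀ i j i' j' → 1 ≤ i → i ≤ suc n → 1 ≤ j → j ≤ n →
  1 ≤ i' → i' ≤ suc n → 1 ≤ j' → j' ≤ n →
  v i j ≡ v i' j' → (i ≡ i') × (j ≡ j')

{-# OPTIONS --safe #-}
-- Read t^Q_k as "at least k variables of Q are true", and let Q be the concatenation of the
-- n columns h_1, …, h_n, each listing the n + 1 variables p_{1,j}, …, p_{n+1,j}.  Unfolding
-- the threshold axioms along a column h gives  t^{hQ'}_k → C(h), t^{Q'}_k, t^{Q'}_{k-1}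
-- where C(h) says that two variables of h are true, and  t^{Q'}_k → t^{Q'}_{k-1}  for k ≠ 0
-- merges the last two alternatives.  Peeling off the columns one at a time turns
-- t^Q_{n+1} into the collision disjunction together with t^ε_1, which is refutable.
-- Every sequent involved has at most 10 formulas, each of size O(n³), and there are
-- O(n³) sequents, so the proof has size O(n⁶).
module Submission where

open import Defs
open import Data.Bool using (T)
open import Data.Integer as ℤ using (ℤ)
open import Data.List using (List; []; _∷_; _++_; length; map; concat; upTo; applyUpTo)
open import Data.List.Membership.Propositional using (_∈_)
open import Data.List.Membership.Propositional.Properties using (∈-++⁺ˡ; ∈-++⁺ʳ)
open import Data.List.Properties using (length-++; length-map; length-upTo; map-∘; map-cong; map-applyUpTo; map-upTo)
open import Data.List.Relation.Binary.Permutation.Propositional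
  using (_↭_; ↭-refl; ↭-trans; ↭-sym; refl; prep; swap)
open import Data.List.Relation.Binary.Permutation.Propositional.Properties using (++-comm)
open import Data.List.Relation.Unary.All as All using (All; []; _∷_)
open import Data.List.Relation.Unary.All.Properties using (++⁺; map⁺)
open import Data.List.Relation.Unary.Any using (here; there)
open import Data.Nat using (ℕ; zero; suc; _+_; _*_; _^_; _∸_; _≤_; _<_; _≤ᵇ_; z≤n; s≤s; NonZero)
open import Data.Nat.ListAction using (sum)
open import Data.Nat.Properties
open import Data.Nat.Tactic.RingSolver using (solve-∀)
open import Data.Product using (Σ; _×_; _,_; proj₁; proj₂)
open import Data.Unit using (tt)
open import Function using (_∘_)
open import Relation.Binary.PropositionalEquality
open import Relation.Nullary using (yes; no)
open import Algebra.Properties.CommutativeSemigroup +-commutativeSemigroup using (interchange)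
open import Algebra.Properties.CommutativeSemigroup *-commutativeSemigroup
  using () renaming (interchange to interchange-*)

≈S-refl : ∀ {S} → S ≈S S
≈S-refl {_ ⇒ _} = ↭-refl , ↭-refl

≈S-trans : ∀ {S S' S''} → S ≈S S' → S' ≈S S'' → S ≈S S''
≈S-trans {_ ⇒ _} {_ ⇒ _} {_ ⇒ _} (p , q) (p' , q') = ↭-trans p p' , ↭-trans q q'

∈⇒∈≈ : ∀ {S L} → S ∈ L → S ∈≈ L
∈⇒∈≈ {S} S∈L = S , S∈L , ≈S-refl

infix 4 _⊆≈_
_⊆≈_ : List Seq → List Seq → Set
L ⊆≈ L' = ∀ {S} → S ∈ L → S ∈≈ L'

∈≈-mono : ∀ {L L' S} → L ⊆≈ L' → S ∈≈ L → S ∈≈ L'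
∈≈-mono L⊆L' (S' , S'∈L , S'≈S) with L⊆L' S'∈L
... | S'' , S''∈L' , S''≈S' = S'' , S''∈L' , ≈S-trans S''≈S' S'≈S

Step-mono : ∀ {L L' S} → L ⊆≈ L' → Step L S → Step L' S
Step-mono f init0     = init0
Step-mono f init1     = init1
Step-mono f (initp p) = initp p
Step-mono f (cut a b) = cut (∈≈-mono f a) (∈≈-mono f b)
Step-mono f (wkL a)   = wkL (∈≈-mono f a)
Step-mono f (wkR a)   = wkR (∈≈-mono f a)
Step-mono f (ctrL a)  = ctrL (∈≈-mono f a)
Step-mono f (ctrR a)  = ctrR (∈≈-mono f a)
Step-mono f (∨L a b)  = ∨L (∈≈-mono f a) (∈≈-mono f b)
Step-mono f (∨R a)    = ∨R (∈≈-mono f a)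
Step-mono f (pdL a b) = pdL (∈≈-mono f a) (∈≈-mono f b)
Step-mono f (pdR a b) = pdR (∈≈-mono f a) (∈≈-mono f b)

IsProof-++ : ∀ {Ax L L'} → IsProof Ax L → IsProof Ax L' → IsProof Ax (L ++ L')
IsProof-++ []               π' = π'
IsProof-++ (axiom a π)      π' = axiom a (IsProof-++ π π')
IsProof-++ (rule st eq π)   π' = rule (Step-mono (∈⇒∈≈ ∘ ∈-++⁺ˡ) st) eq (IsProof-++ π π')

proofSize-≤ : ∀ b L → All (λ S → sizeSeq S ≤ b) L → proofSize L ≤ length L * b
proofSize-≤ b []      []       = z≤n
proofSize-≤ b (S ∷ L) (h ∷ hs) = +-mono-≤ h (proofSize-≤ b L hs)

module Derivations (Ax : Seq → Set) (Ok : Seq → Set) where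

  data Der : ℕ → Seq → Set where
    ax      : ∀ {S} → Ax S → Ok S → Der 1 S
    rule₀   : ∀ {S} → Step [] S → Ok S → Der 1 S
    rule₁   : ∀ {a P S} → Der a P → Step (P ∷ []) S → Ok S → Der (suc a) S
    rule₂   : ∀ {a b P P' S} → Der a P → Der b P' → Step (P ∷ P' ∷ []) S → Ok S →
              Der (suc (a + b)) S
    reorder : ∀ {a S S'} → Der a S → S ≈S S' → Der a S'

  OkProof : ℕ → (Seq → List Seq → Set) → Seq → Set
  OkProof c _occurs-in_ S =
    Σ (List Seq) λ L → IsProof Ax L × (S occurs-in L) × (length L ≡ c) × All Ok L

  flatten : ∀ {c S} → Der c S → OkProof c _∈≈_ S
  flatten (ax {S} a ok) = S ∷ [] , axiom a [] , ∈⇒∈≈ (here refl) , refl , ok ∷ []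
  flatten (rule₀ {S} st ok) =
    S ∷ [] , rule (Step-mono (λ ()) st) ≈S-refl [] , ∈⇒∈≈ (here refl) , refl , ok ∷ []
  flatten (rule₁ {S = S} d st ok) with flatten d
  ... | L , π , P∈L , refl , oks =
    S ∷ L , rule (Step-mono (λ { (here refl) → P∈L }) st) ≈S-refl π , ∈⇒∈≈ (here refl) ,
    refl , ok ∷ oks
  flatten (rule₂ {S = S} d d' st ok) with flatten d | flatten d'
  ... | L , π , (Q , Q∈L , Q≈P) , refl , oks | L' , π' , (Q' , Q'∈L' , Q'≈P') , refl , oks' =
    S ∷ L ++ L' , rule (Step-mono premises st) ≈S-refl (IsProof-++ π π') ,
    ∈⇒∈≈ (here refl) , cong suc (length-++ L) , ok ∷ ++⁺ oks oks'
    where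
      premises : _ ∷ _ ∷ [] ⊆≈ L ++ L'
      premises (here refl)         = Q , ∈-++⁺ˡ Q∈L , Q≈P
      premises (there (here refl)) = Q' , ∈-++⁺ʳ L Q'∈L' , Q'≈P'
  flatten (reorder d S≈S') with flatten d
  ... | L , π , (Q , Q∈L , Q≈S) , len , oks = L , π , (Q , Q∈L , ≈S-trans Q≈S S≈S') , len , oks

  flattenThen : ∀ {c P S} → Der c P → Step (P ∷ []) S → Ok S → OkProof (suc c) _∈_ S
  flattenThen {S = S} d st ok with flatten d
  ... | L , π , P∈L , len , oks =
    S ∷ L , rule (Step-mono (λ { (here refl) → P∈L }) st) ≈S-refl π , here refl , cong suc len , ok ∷ oks

infix 4 _⊢_
_⊢_ : List Fm → List Fm → Seq
Γ ⊢ Δ = Γ ⇒ Δ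

prev : ℤ → ℤ
prev k = k ℤ.- ℤ.+ 1

rotate₃ : ∀ {A : Set} (a b c : A) {r : List A} → a ∷ b ∷ c ∷ r ↭ c ∷ a ∷ b ∷ r
rotate₃ a b c = ↭-trans (prep a (swap b c refl)) (swap a c refl)

both : ℕ → ℕ → Fm
both x y = pd 𝟘 x (var y)

collisionWith : ℕ → List ℕ → Fm
collisionWith x ys = ⋁ (map (both x) ys)

collisionRows : List ℕ → List Fm
collisionRows []           = []
collisionRows (x ∷ [])     = []
collisionRows (x ∷ y ∷ ys) = collisionWith x (y ∷ ys) ∷ collisionRows (y ∷ ys)

collision : List ℕ → Fm
collision h = ⋁ (collisionRows h)

anyCollision : List (List ℕ) → Fm
anyCollision hs = ⋁ (map collision hs)

Hole : Set
Hole = ℕ × ℕ × List ℕ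

vars : Hole → List ℕ
vars (x , y , ys) = x ∷ y ∷ ys

-- Exact numbers of sequents in the derivations threshold-pred, threshold-collisionWith,
-- threshold-collision and pigeonhole below, as forced by their indices.
predCost : List ℕ → ℕ
predCost []       = 6
predCost (_ ∷ ps) = 36 + predCost ps

collisionWithCost : List ℕ → ℕ
collisionWithCost []       = 23
collisionWithCost (_ ∷ zs) = 19 + collisionWithCost zs

collisionCost : List ℕ → ℕ
collisionCost []       = 51
collisionCost (_ ∷ zs) = 29 + (collisionWithCost zs + (1 + collisionCost zs))

pigeonholeCost : List Hole → ℕ
pigeonholeCost []                     = 5
pigeonholeCost ((_ , _ , ys) ∷ [])    = 15 + collisionCost ys
pigeonholeCost ((_ , _ , ys) ∷ h ∷ hs) =
  4 + (pigeonholeCost (h ∷ hs) + (6 + (predCost (concat (map vars (h ∷ hs))) + (1 + collisionCost ys))))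

module Sized (P : ℕ) (6≤P : 6 ≤ P) where

  record Small (A : Fm) : Set where
    constructor small
    field size≤ : size A ≤ P

  Bounded : Seq → Set
  Bounded (Γ ⇒ Δ) = All Small Γ × All Small Δ × (length Γ + length Δ ≤ 10)

  open Derivations 𝒯 Bounded public

  bounded : ∀ {Γ Δ} → All Small Γ → All Small Δ → T (length Γ + length Δ ≤ᵇ 10) → Bounded (Γ ⊢ Δ)
  bounded {Γ} {Δ} sΓ sΔ t = sΓ , sΔ , ≤ᵇ⇒≤ (length Γ + length Δ) 10 t

  bounded-dropL : ∀ Γ' {Γ Δ} → Bounded (Γ' ++ Γ ⊢ Δ) → Bounded (Γ ⊢ Δ)
  bounded-dropL []       b                 = b
  bounded-dropL (_ ∷ Γ') (_ ∷ sΓ , sΔ , l) = bounded-dropL Γ' (sΓ , sΔ , ≤-trans (n≤1+n _) l)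

  bounded-dropR : ∀ Δ' {Γ Δ} → Bounded (Γ ⊢ Δ' ++ Δ) → Bounded (Γ ⊢ Δ)
  bounded-dropR []                   b                 = b
  bounded-dropR (_ ∷ Δ') {Γ} {Δ} (sΓ , _ ∷ sΔ , l) =
    bounded-dropR Δ' (sΓ , sΔ , ≤-trans (≤-trans (n≤1+n _) (≤-reflexive (sym (+-suc (length Γ) _)))) l)

  sizeSeq-≤ : ∀ {S} → Bounded S → sizeSeq S ≤ 10 * P + 1
  sizeSeq-≤ {Γ ⇒ Δ} (sΓ , sΔ , l) = +-monoˡ-≤ 1 (begin
    sum (map size Γ) + sum (map size Δ) ≤⟨ +-mono-≤ (sum-≤ sΓ) (sum-≤ sΔ) ⟩
    length Γ * P + length Δ * P         ≡⟨ *-distribʳ-+ P (length Γ) (length Δ) ⟨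
    (length Γ + length Δ) * P           ≤⟨ *-monoˡ-≤ P l ⟩
    10 * P                              ∎)
    where
      open ≤-Reasoning
      sum-≤ : ∀ {As} → All Small As → sum (map size As) ≤ length As * P
      sum-≤ []             = z≤n
      sum-≤ (small h ∷ hs) = +-mono-≤ h (sum-≤ hs)

  small-atom : ∀ {A} → size A ≡ 1 → Small A
  small-atom eq = small (≤-trans (≤-reflexive eq) (≤-trans (s≤s z≤n) 6≤P))

  small-var : ∀ {p} → Small (var p)
  small-var = small-atom refl

  small-𝟘 : Small 𝟘
  small-𝟘 = small-atom refl

  small-ext : ∀ {Q k} → Small (ext Q k)
  small-ext = small-atom refl

  small-def : ∀ {e A} → ThrDef e A → Small A
  small-def t-nil0          = small-atom refl
  small-def (t-nilk _ _)    = small-𝟘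
  small-def (t-cons _ _ _)  = small 6≤P

  small-defined : ∀ {e A} → ThrDef e A → Small e
  small-defined t-nil0         = small-ext
  small-defined (t-nilk _ _)   = small-ext
  small-defined (t-cons _ _ _) = small-ext

  small-both : ∀ {x y} → Small (both x y)
  small-both = small 6≤P

  private
    latest : ∀ {S L} → S ∈≈ (S ∷ L)
    latest = ∈⇒∈≈ (here refl)

    previous : ∀ {S S' L} → S ∈≈ (S' ∷ S ∷ L)
    previous = ∈⇒∈≈ (there (here refl))

  init-varᴰ : ∀ p → Der 1 (var p ∷ [] ⊢ var p ∷ [])
  init-varᴰ p = rule₀ (initp p) (bounded (small-var ∷ []) (small-var ∷ []) tt)

  init-𝟘ᴰ : Der 1 (𝟘 ∷ [] ⊢ [])
  init-𝟘ᴰ = rule₀ init0 (bounded (small-𝟘 ∷ []) [] tt)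

  cutᴰ : ∀ {a c Γ Δ A} → Der a (Γ ⊢ A ∷ Δ) → Der c (A ∷ Γ ⊢ Δ) → Bounded (Γ ⊢ Δ) →
         Der (suc (a + c)) (Γ ⊢ Δ)
  cutᴰ d d' = rule₂ d d' (cut latest previous)

  cutᴰ′ : ∀ {a c Γ Δ A} → Der a (A ∷ Γ ⊢ Δ) → Der c (Γ ⊢ A ∷ Δ) → Bounded (Γ ⊢ Δ) →
          Der (suc (a + c)) (Γ ⊢ Δ)
  cutᴰ′ d d' = rule₂ d d' (cut previous latest)

  wkLᴰ : ∀ {a Γ Δ A} → Der a (Γ ⊢ Δ) → Bounded (A ∷ Γ ⊢ Δ) → Der (suc a) (A ∷ Γ ⊢ Δ)
  wkLᴰ d = rule₁ d (wkL latest)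

  wkRᴰ : ∀ {a Γ Δ A} → Der a (Γ ⊢ Δ) → Bounded (Γ ⊢ A ∷ Δ) → Der (suc a) (Γ ⊢ A ∷ Δ)
  wkRᴰ d = rule₁ d (wkR latest)

  ctrRᴰ : ∀ {a Γ Δ A} → Der a (Γ ⊢ A ∷ A ∷ Δ) → Bounded (Γ ⊢ A ∷ Δ) → Der (suc a) (Γ ⊢ A ∷ Δ)
  ctrRᴰ d = rule₁ d (ctrR latest)

  ∨Rᴰ : ∀ {a Γ Δ A B} → Der a (Γ ⊢ A ∷ B ∷ Δ) → Bounded (Γ ⊢ (A ∨ B) ∷ Δ) →
        Der (suc a) (Γ ⊢ (A ∨ B) ∷ Δ)
  ∨Rᴰ d = rule₁ d (∨R latest)

  pdLᴰ : ∀ {a c Γ Δ A p B} → Der a (A ∷ Γ ⊢ Δ) → Der c (var p ∷ B ∷ Γ ⊢ Δ) →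
         Bounded (pd A p B ∷ Γ ⊢ Δ) → Der (suc (a + c)) (pd A p B ∷ Γ ⊢ Δ)
  pdLᴰ d d' = rule₂ d d' (pdL latest previous)

  pdLᴰ′ : ∀ {a c Γ Δ A p B} → Der a (var p ∷ B ∷ Γ ⊢ Δ) → Der c (A ∷ Γ ⊢ Δ) →
          Bounded (pd A p B ∷ Γ ⊢ Δ) → Der (suc (a + c)) (pd A p B ∷ Γ ⊢ Δ)
  pdLᴰ′ d d' = rule₂ d d' (pdL previous latest)

  pdRᴰ : ∀ {a c Γ Δ A p B} → Der a (Γ ⊢ A ∷ var p ∷ Δ) → Der c (Γ ⊢ A ∷ B ∷ Δ) →
         Bounded (Γ ⊢ pd A p B ∷ Δ) → Der (suc (a + c)) (Γ ⊢ pd A p B ∷ Δ)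
  pdRᴰ d d' = rule₂ d d' (pdR latest previous)

  wkRsᴰ : ∀ {c Γ Δ} → Der c (Γ ⊢ Δ) → ∀ Δ' → Bounded (Γ ⊢ Δ' ++ Δ) →
          Der (length Δ' + c) (Γ ⊢ Δ' ++ Δ)
  wkRsᴰ d []       b = d
  wkRsᴰ d (_ ∷ Δ') b = wkRᴰ (wkRsᴰ d Δ' (bounded-dropR (_ ∷ []) b)) b

  wkLsᴰ : ∀ {c Γ Δ} → Der c (Γ ⊢ Δ) → ∀ Γ' → Bounded (Γ' ++ Γ ⊢ Δ) →
          Der (length Γ' + c) (Γ' ++ Γ ⊢ Δ)
  wkLsᴰ d []       b = d
  wkLsᴰ d (_ ∷ Γ') b = wkLᴰ (wkLsᴰ d Γ' (bounded-dropL (_ ∷ []) b)) b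

  weakenᴰ : ∀ {c Γ Δ} → Der c (Γ ⊢ Δ) → ∀ Γ' Δ' → Bounded (Γ' ++ Γ ⊢ Δ' ++ Δ) →
            Der (length Γ' + (length Δ' + c)) (Γ' ++ Γ ⊢ Δ' ++ Δ)
  weakenᴰ d Γ' Δ' b = wkLsᴰ (wkRsᴰ d Δ' (bounded-dropL Γ' b)) Γ' b

  private
    room : ∀ (Γ Δ : List Fm) i j → T (length Γ + length Δ ≤ᵇ 8) → i + j ≤ 2 →
           (i + length Γ) + (j + length Δ) ≤ 10
    room Γ Δ i j t ij = begin
      (i + length Γ) + (j + length Δ) ≡⟨ interchange i (length Γ) j (length Δ) ⟩
      (i + j) + (length Γ + length Δ) ≤⟨ +-mono-≤ ij (≤ᵇ⇒≤ (length Γ + length Δ) 8 t) ⟩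
      10                              ∎
      where open ≤-Reasoning

    length-∷ʳ : ∀ (Γ : List Fm) X → length (Γ ++ X ∷ []) ≡ 1 + length Γ
    length-∷ʳ Γ X = trans (length-++ Γ) (+-comm (length Γ) 1)

    bounded-∷ʳ : ∀ {Γ Δ X Y} → All Small Γ → All Small Δ → Small X → Small Y →
                 T (length Γ + length Δ ≤ᵇ 8) → Bounded (Γ ++ X ∷ [] ⊢ Δ ++ Y ∷ [])
    bounded-∷ʳ {Γ} {Δ} {X} {Y} sΓ sΔ sX sY t =
      ++⁺ sΓ (sX ∷ []) , ++⁺ sΔ (sY ∷ []) ,
      subst (_≤ 10) (sym (cong₂ _+_ (length-∷ʳ Γ X) (length-∷ʳ Δ Y))) (room Γ Δ 1 1 t ≤-refl)

  replaceL : ∀ {a c X Y Γ Δ} → Der a (X ∷ [] ⊢ Y ∷ []) → Der c (Y ∷ Γ ⊢ Δ) →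
             All Small Γ → All Small Δ → Small X → Small Y → T (length Γ + length Δ ≤ᵇ 8) →
             Der (suc (length Γ + (length Δ + a) + suc c)) (X ∷ Γ ⊢ Δ)
  replaceL {X = X} {Y} {Γ} {Δ} dXY d sΓ sΔ sX sY t =
    cutᴰ (reorder (weakenᴰ dXY Γ Δ (bounded-∷ʳ sΓ sΔ sX sY t)) (++-comm Γ (X ∷ []) , ++-comm Δ (Y ∷ [])))
         (reorder (wkLᴰ d (sX ∷ sY ∷ sΓ , sΔ , room Γ Δ 2 0 t (s≤s (s≤s z≤n)))) (swap X Y refl , refl))
         (sX ∷ sΓ , sΔ , room Γ Δ 1 0 t (s≤s z≤n))

  replaceR : ∀ {a c X Y Γ Δ} → Der c (Γ ⊢ X ∷ Δ) → Der a (X ∷ [] ⊢ Y ∷ []) →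
             All Small Γ → All Small Δ → Small X → Small Y → T (length Γ + length Δ ≤ᵇ 8) →
             Der (suc (length Γ + (length Δ + a) + suc c)) (Γ ⊢ Y ∷ Δ)
  replaceR {X = X} {Y} {Γ} {Δ} d dXY sΓ sΔ sX sY t =
    cutᴰ′ (reorder (weakenᴰ dXY Γ Δ (bounded-∷ʳ sΓ sΔ sX sY t)) (++-comm Γ (X ∷ []) , ++-comm Δ (Y ∷ [])))
          (reorder (wkRᴰ d (sΓ , sY ∷ sX ∷ sΔ , room Γ Δ 0 2 t ≤-refl)) (refl , swap Y X refl))
          (sΓ , sY ∷ sΔ , room Γ Δ 0 1 t (s≤s z≤n))

  -- There are no initial sequents e → e for extension variables; they are obtained by
  -- cutting the two halves of a defining axiom.
  ext-id : ∀ {e A} → ThrDef e A → Der 5 (e ∷ [] ⊢ e ∷ [])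
  ext-id {e} {A} def =
    cutᴰ (reorder (wkRᴰ (ax (ax→ def) (bounded (se ∷ []) (sA ∷ []) tt))
                        (bounded (se ∷ []) (se ∷ sA ∷ []) tt))
                  (refl , swap e A refl))
         (reorder (wkLᴰ (ax (ax← def) (bounded (sA ∷ []) (se ∷ []) tt))
                        (bounded (se ∷ sA ∷ []) (se ∷ []) tt))
                  (swap e A refl , refl))
         (bounded (se ∷ []) (se ∷ []) tt)
    where se = small-defined def
          sA = small-def def

  threshold-id : ∀ Q k → Der 5 (ext Q k ∷ [] ⊢ ext Q k ∷ [])
  threshold-id (p ∷ ps) k = ext-id (t-cons p ps k)
  threshold-id []       k with k ℤ.≟ ℤ.+ 0
  ... | yes refl = ext-id t-nil0
  ... | no k≢0   = ext-id (t-nilk k k≢0)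

  empty-threshold-⊥ : ∀ k → k ≢ ℤ.+ 0 → Der 4 (ext [] k ∷ [] ⊢ [])
  empty-threshold-⊥ k k≢0 =
    cutᴰ (ax (ax→ (t-nilk k k≢0)) (bounded (small-ext ∷ []) (small-𝟘 ∷ []) tt))
         (reorder (wkLᴰ init-𝟘ᴰ (bounded (small-ext ∷ small-𝟘 ∷ []) [] tt)) (swap _ _ refl , refl))
         (bounded (small-ext ∷ []) [] tt)

  both-intro : ∀ x y → Der 7 (var x ∷ var y ∷ [] ⊢ both x y ∷ [])
  both-intro x y =
    pdRᴰ (reorder (weakenᴰ (init-varᴰ x) (var y ∷ []) (𝟘 ∷ []) b) (swap _ _ refl , refl))
         (weakenᴰ (init-varᴰ y) (var x ∷ []) (𝟘 ∷ []) b)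
         (bounded (small-var ∷ small-var ∷ []) (small-both ∷ []) tt)
    where b : ∀ {u w} → Bounded (var u ∷ var w ∷ [] ⊢ 𝟘 ∷ var w ∷ [])
          b = bounded (small-var ∷ small-var ∷ []) (small-𝟘 ∷ small-var ∷ []) tt

  unfoldL : ∀ {c p Q k Γ Δ} → Der c (pd (ext Q k) p (ext Q (prev k)) ∷ Γ ⊢ Δ) →
            All Small Γ → All Small Δ → T (length Γ + length Δ ≤ᵇ 8) →
            Der (suc (length Γ + (length Δ + 1) + suc c)) (ext (p ∷ Q) k ∷ Γ ⊢ Δ)
  unfoldL d sΓ sΔ t =
    replaceL (ax (ax→ (t-cons _ _ _)) (bounded (small-ext ∷ []) (small-def (t-cons _ _ _) ∷ []) tt))
             d sΓ sΔ small-ext (small-def (t-cons _ _ _)) t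

  foldR : ∀ {c p Q k Γ Δ} → Der c (Γ ⊢ pd (ext Q k) p (ext Q (prev k)) ∷ Δ) →
          All Small Γ → All Small Δ → T (length Γ + length Δ ≤ᵇ 8) →
          Der (suc (length Γ + (length Δ + 1) + suc c)) (Γ ⊢ ext (p ∷ Q) k ∷ Δ)
  foldR d sΓ sΔ t =
    replaceR d (ax (ax← (t-cons _ _ _)) (bounded (small-def (t-cons _ _ _) ∷ []) (small-ext ∷ []) tt))
             sΓ sΔ (small-def (t-cons _ _ _)) small-ext t

  threshold-split : ∀ p Q k → Der 19 (ext (p ∷ Q) k ∷ [] ⊢ ext Q k ∷ ext Q (prev k) ∷ [])
  threshold-split p Q k =
    unfoldL (pdLᴰ (reorder (weakenᴰ (threshold-id Q k) [] (ext Q (prev k) ∷ [])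
                                     (bounded (small-ext ∷ []) (small-ext ∷ small-ext ∷ []) tt))
                            (refl , swap _ _ refl))
                   (weakenᴰ (threshold-id Q (prev k)) (var p ∷ []) (ext Q k ∷ [])
                            (bounded (small-var ∷ small-ext ∷ []) (small-ext ∷ small-ext ∷ []) tt))
                   (bounded (small-def (t-cons p Q k) ∷ []) (small-ext ∷ small-ext ∷ []) tt))
            [] (small-ext ∷ small-ext ∷ []) tt

  -- In the branch where p is false this is the induction hypothesis; where p is true,
  -- t^Q_{k-1} already implies the unfolding pd(t^Q_{k-1}, p, t^Q_{k-2}) of t^{pQ}_{k-1}.
  threshold-pred : ∀ Q k → k ≢ ℤ.+ 0 → Der (predCost Q) (ext Q k ∷ [] ⊢ ext Q (prev k) ∷ [])
  threshold-pred [] k k≢0 =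
    cutᴰ (reorder (wkRᴰ (ax (ax→ (t-nilk k k≢0)) (bounded (small-ext ∷ []) (small-𝟘 ∷ []) tt))
                        (bounded (small-ext ∷ []) (small-ext ∷ small-𝟘 ∷ []) tt))
                  (refl , swap _ _ refl))
         (reorder (weakenᴰ init-𝟘ᴰ (ext [] k ∷ []) (ext [] (prev k) ∷ [])
                           (bounded (small-ext ∷ small-𝟘 ∷ []) (small-ext ∷ []) tt))
                  (swap _ _ refl , refl))
         (bounded (small-ext ∷ []) (small-ext ∷ []) tt)
  threshold-pred (p ∷ Q) k k≢0 =
    foldR (unfoldL (pdLᴰ′ (pdRᴰ (reorder (weakenᴰ (init-varᴰ p) (lower ∷ []) (lower ∷ []) b₁) (swap _ _ refl , refl))
                                 (reorder (weakenᴰ (threshold-id Q (prev k)) (var p ∷ []) (lower² ∷ []) b₂)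
                                          (refl , swap _ _ refl))
                                 (bounded (small-var ∷ small-ext ∷ []) (sLower ∷ []) tt))
                           (replaceR (threshold-pred Q k k≢0) lower⊢lowerPd (small-ext ∷ []) [] small-ext sLower tt)
                           (bounded (small-def (t-cons p Q k) ∷ []) (sLower ∷ []) tt))
                   [] (sLower ∷ []) tt)
          (small-ext ∷ []) [] tt
    where
      lower  = ext Q (prev k)
      lower² = ext Q (prev (prev k))
      sLower = small-def (t-cons p Q (prev k))
      b₁ = bounded (small-ext ∷ small-var ∷ []) (small-ext ∷ small-var ∷ []) tt
      b₂ = bounded (small-var ∷ small-ext ∷ []) (small-ext ∷ small-ext ∷ []) tt
      lower⊢lowerPd : Der 13 (lower ∷ [] ⊢ pd lower p lower² ∷ [])
      lower⊢lowerPd =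
        pdRᴰ (reorder (weakenᴰ (threshold-id Q (prev k)) [] (var p ∷ [])
                               (bounded (small-ext ∷ []) (small-var ∷ small-ext ∷ []) tt))
                      (refl , swap _ _ refl))
             (reorder (weakenᴰ (threshold-id Q (prev k)) [] (lower² ∷ [])
                               (bounded (small-ext ∷ []) (small-ext ∷ small-ext ∷ []) tt))
                      (refl , swap _ _ refl))
             (bounded (small-ext ∷ []) (sLower ∷ []) tt)

  module Collisions
    (m : ℕ)
    (small-collisionWith : ∀ x ys → length ys ≤ m → Small (collisionWith x ys))
    (small-collision : ∀ h → length h ≤ m → Small (collision h))
    (small-anyCollision : ∀ hs → length hs ≤ m → All (λ h → length (vars h) ≤ m) hs →
                          Small (anyCollision (map vars hs)))
    where

    threshold-collisionWith : ∀ x y ys Q k → length (y ∷ ys) ≤ m →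
      Der (collisionWithCost ys)
          (ext (y ∷ ys ++ Q) k ∷ var x ∷ [] ⊢ collisionWith x (y ∷ ys) ∷ ext Q k ∷ [])
    threshold-collisionWith x y [] Q k _ =
      unfoldL (pdLᴰ′ (reorder (weakenᴰ (both-intro x y) (ext Q (prev k) ∷ []) (ext Q k ∷ [])
                                       (bounded (small-ext ∷ small-var ∷ small-var ∷ [])
                                                (small-ext ∷ small-both ∷ []) tt))
                              (rotate₃ _ _ _ , swap _ _ refl))
                     (reorder (weakenᴰ (threshold-id Q k) (var x ∷ []) (both x y ∷ [])
                                       (bounded (small-var ∷ small-ext ∷ []) (small-both ∷ small-ext ∷ []) tt))
                              (swap _ _ refl , refl))
                     (bounded (small-def (t-cons y Q k) ∷ small-var ∷ []) (small-both ∷ small-ext ∷ []) tt))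
              (small-var ∷ []) (small-both ∷ small-ext ∷ []) tt
    threshold-collisionWith x y (z ∷ zs) Q k |yzzs|≤m =
      unfoldL (∨Rᴰ (pdLᴰ′ (reorder (weakenᴰ (both-intro x y) (ext (z ∷ zs ++ Q) (prev k) ∷ [])
                                            (rest ∷ ext Q k ∷ [])
                                            (bounded (small-ext ∷ small-var ∷ small-var ∷ [])
                                                     (sRest ∷ small-ext ∷ small-both ∷ []) tt))
                                   (rotate₃ _ _ _ , rotate₃ _ _ _))
                          (wkRᴰ (threshold-collisionWith x z zs Q k |zzs|≤m)
                                (bounded (small-ext ∷ small-var ∷ []) (small-both ∷ sRest ∷ small-ext ∷ []) tt))
                          (bounded (small-def (t-cons y (z ∷ zs ++ Q) k) ∷ small-var ∷ [])
                                   (small-both ∷ sRest ∷ small-ext ∷ []) tt))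
                   (bounded (small-def (t-cons y (z ∷ zs ++ Q) k) ∷ small-var ∷ []) (sAll ∷ small-ext ∷ []) tt))
              (small-var ∷ []) (sAll ∷ small-ext ∷ []) tt
      where
        rest = collisionWith x (z ∷ zs)
        |zzs|≤m = ≤-trans (n≤1+n _) |yzzs|≤m
        sRest = small-collisionWith x (z ∷ zs) |zzs|≤m
        sAll = small-collisionWith x (y ∷ z ∷ zs) |yzzs|≤m

    -- If x is false, recurse on y ∷ ys; if x is true, k - 1 variables of y ∷ ys ++ Q are
    -- true and threshold-collisionWith finds either a partner of x or k - 1 true in Q.
    threshold-collision : ∀ x y ys Q k → length (x ∷ y ∷ ys) ≤ m →
      Der (collisionCost ys)
          (ext (x ∷ y ∷ ys ++ Q) k ∷ [] ⊢ collision (x ∷ y ∷ ys) ∷ ext Q k ∷ ext Q (prev k) ∷ [])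
    threshold-collision x y [] Q k |xy|≤m =
      unfoldL (pdLᴰ (wkRᴰ (threshold-split y Q k)
                          (bounded (small-ext ∷ []) (sRow ∷ small-ext ∷ small-ext ∷ []) tt))
                    (reorder (weakenᴰ (threshold-collisionWith x y [] Q (prev k) |y|≤m) [] (ext Q k ∷ [])
                                      (bounded (small-ext ∷ small-var ∷ []) (small-ext ∷ sRow ∷ small-ext ∷ []) tt))
                             (swap _ _ refl , swap _ _ refl))
                    (bounded (small-def (t-cons x (y ∷ Q) k) ∷ []) (sRow ∷ small-ext ∷ small-ext ∷ []) tt))
              [] (sRow ∷ small-ext ∷ small-ext ∷ []) tt
      where
        |y|≤m = ≤-trans (n≤1+n _) |xy|≤m
        sRow = small-collisionWith x (y ∷ []) |y|≤m
    threshold-collision x y (z ∷ zs) Q k |xyzzs|≤m =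
      unfoldL (∨Rᴰ (pdLᴰ′ (reorder (weakenᴰ (threshold-collisionWith x y (z ∷ zs) Q (prev k) |yzzs|≤m) []
                                            (rest ∷ ext Q k ∷ [])
                                            (bounded (small-ext ∷ small-var ∷ [])
                                                     (sRest ∷ small-ext ∷ sRow ∷ small-ext ∷ []) tt))
                                   (swap _ _ refl , rotate₃ _ _ _))
                          (wkRᴰ (threshold-collision y z zs Q k |yzzs|≤m)
                                (bounded (small-ext ∷ []) (sRow ∷ sRest ∷ small-ext ∷ small-ext ∷ []) tt))
                          (bounded (small-def (t-cons x (y ∷ z ∷ zs ++ Q) k) ∷ [])
                                   (sRow ∷ sRest ∷ small-ext ∷ small-ext ∷ []) tt))
                   (bounded (small-def (t-cons x (y ∷ z ∷ zs ++ Q) k) ∷ [])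
                            (sAll ∷ small-ext ∷ small-ext ∷ []) tt))
              [] (sAll ∷ small-ext ∷ small-ext ∷ []) tt
      where
        |yzzs|≤m = ≤-trans (n≤1+n _) |xyzzs|≤m
        rest = collision (y ∷ z ∷ zs)
        sRow = small-collisionWith x (y ∷ z ∷ zs) |yzzs|≤m
        sRest = small-collision (y ∷ z ∷ zs) |yzzs|≤m
        sAll = small-collision (x ∷ y ∷ z ∷ zs) |xyzzs|≤m

    -- With one column left, both thresholds that remain besides the collision are over the
    -- empty list and refutable; otherwise threshold-pred merges them into t^Q_{k-1}.
    pigeonhole : ∀ hs r → length hs ≤ r → length hs ≤ m → All (λ h → length (vars h) ≤ m) hs →
      Der (pigeonholeCost hs) (ext (concat (map vars hs)) (ℤ.+ suc r) ∷ [] ⊢ anyCollision (map vars hs) ∷ [])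
    pigeonhole [] r _ _ _ =
      wkRᴰ (empty-threshold-⊥ (ℤ.+ suc r) (λ ())) (bounded (small-ext ∷ []) (small-𝟘 ∷ []) tt)
    pigeonhole ((x , y , ys) ∷ []) (suc r) _ _ (|h|≤m ∷ []) =
      cutᴰ′ (reorder (weakenᴰ (empty-threshold-⊥ (ℤ.+ suc (suc r)) (λ ())) (t ∷ []) (C ∷ [])
                              (bounded (small-ext ∷ small-ext ∷ []) (sC ∷ []) tt))
                     (swap _ _ refl , refl))
            (reorder (cutᴰ′ (reorder (weakenᴰ (empty-threshold-⊥ (ℤ.+ suc r) (λ ())) (t ∷ [])
                                              (C ∷ ext [] (ℤ.+ suc (suc r)) ∷ [])
                                              (bounded (small-ext ∷ small-ext ∷ []) (sC ∷ small-ext ∷ []) tt))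
                                     (swap _ _ refl , refl))
                            (reorder (threshold-collision x y ys [] (ℤ.+ suc (suc r)) |h|≤m) (refl , rotate₃ _ _ _))
                            (bounded (small-ext ∷ []) (sC ∷ small-ext ∷ []) tt))
                     (refl , swap _ _ refl))
            (bounded (small-ext ∷ []) (sC ∷ []) tt)
      where
        t = ext (x ∷ y ∷ ys ++ []) (ℤ.+ suc (suc r))
        C = collision (x ∷ y ∷ ys)
        sC = small-collision (x ∷ y ∷ ys) |h|≤m
    pigeonhole ((x , y , ys) ∷ h ∷ hs) (suc (suc r)) (s≤s |hhs|≤r) |hhs|≤m (|h|≤m ∷ all≤m) =
      ∨Rᴰ (reorder (replaceR (ctrRᴰ (replaceR (reorder (threshold-collision x y ys Q k |h|≤m)
                                                        (refl , ↭-sym (rotate₃ _ _ _)))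
                                              (threshold-pred Q k (λ ()))
                                              (small-ext ∷ []) (small-ext ∷ sC ∷ []) small-ext small-ext tt)
                                    (bounded (small-ext ∷ []) (small-ext ∷ sC ∷ []) tt))
                             (pigeonhole (h ∷ hs) (suc r) |hhs|≤r |hs|≤m all≤m)
                             (small-ext ∷ []) (sC ∷ []) small-ext (small-anyCollision (h ∷ hs) |hs|≤m all≤m) tt)
                   (refl , swap _ _ refl))
          (bounded (small-ext ∷ []) (small-anyCollision ((x , y , ys) ∷ h ∷ hs) |hhs|≤m (|h|≤m ∷ all≤m) ∷ []) tt)
      where
        k = ℤ.+ suc (suc (suc r))
        Q = concat (map vars (h ∷ hs))
        |hs|≤m = ≤-trans (n≤1+n _) |hhs|≤m
        sC = small-collision (x ∷ y ∷ ys) |h|≤m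

size-⋁ : ∀ {b} As → All (λ A → size A ≤ b) As → size (⋁ As) ≤ suc (length As * suc b)
size-⋁ []           []       = s≤s z≤n
size-⋁ {b} (A ∷ [])     (h ∷ []) = ≤-trans h (≤-trans (n≤1+n b) (s≤s (m≤n⇒m≤1+n (m≤m+n b _))))
size-⋁ {b} (A ∷ B ∷ As) (h ∷ hs) = begin
  size A + size (⋁ (B ∷ As)) + 1 ≤⟨ +-monoˡ-≤ 1 (+-mono-≤ h (size-⋁ (B ∷ As) hs)) ⟩
  b + suc X + 1                  ≡⟨ +-comm (b + suc X) 1 ⟩
  suc (b + suc X)                ≡⟨ cong suc (+-suc b X) ⟩
  suc (suc b + X)                ∎
  where
    open ≤-Reasoning
    X = length (B ∷ As) * suc b

rowBound holeBound collisionsBound : ℕ → ℕ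
rowBound        m = suc (m * 7)
holeBound       m = suc (m * suc (rowBound m))
collisionsBound m = suc (m * suc (holeBound m))

size-collisionWith : ∀ {m} x ys → length ys ≤ m → size (collisionWith x ys) ≤ rowBound m
size-collisionWith x ys |ys|≤m =
  ≤-trans (size-⋁ (map (both x) ys) (map⁺ (All.universal (λ _ → ≤-refl {6}) ys)))
          (s≤s (*-monoˡ-≤ 7 (≤-trans (≤-reflexive (length-map (both x) ys)) |ys|≤m)))

length-collisionRows : ∀ h → length (collisionRows h) ≤ length h
length-collisionRows []           = z≤n
length-collisionRows (x ∷ [])     = z≤n
length-collisionRows (x ∷ y ∷ ys) = s≤s (length-collisionRows (y ∷ ys))

size-collisionRows : ∀ {m} h → length h ≤ m → All (λ A → size A ≤ rowBound m) (collisionRows h)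
size-collisionRows []           _      = []
size-collisionRows (x ∷ [])     _      = []
size-collisionRows (x ∷ y ∷ ys) |h|≤m =
  size-collisionWith x (y ∷ ys) |yys|≤m ∷ size-collisionRows (y ∷ ys) |yys|≤m
  where |yys|≤m = ≤-trans (n≤1+n _) |h|≤m

size-collision : ∀ {m} h → length h ≤ m → size (collision h) ≤ holeBound m
size-collision h |h|≤m =
  ≤-trans (size-⋁ (collisionRows h) (size-collisionRows h |h|≤m))
          (s≤s (*-monoˡ-≤ _ (≤-trans (length-collisionRows h) |h|≤m)))

size-anyCollision : ∀ {m} hs → length hs ≤ m → All (λ h → length (vars h) ≤ m) hs →
                    size (anyCollision (map vars hs)) ≤ collisionsBound m
size-anyCollision hs |hs|≤m all≤m =
  ≤-trans (size-⋁ (map collision (map vars hs)) (map⁺ (map⁺ (All.map (λ {h} → size-collision (vars h)) all≤m))))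
          (s≤s (*-monoˡ-≤ _ (≤-trans (≤-reflexive (trans (length-map collision (map vars hs)) (length-map vars hs))) |hs|≤m)))

length-concat-vars : ∀ {m} hs → All (λ h → length (vars h) ≤ m) hs →
                     length (concat (map vars hs)) ≤ length hs * m
length-concat-vars []       []             = z≤n
length-concat-vars (h ∷ hs) (|h|≤m ∷ all≤m) =
  ≤-trans (≤-reflexive (length-++ (vars h))) (+-mono-≤ |h|≤m (length-concat-vars hs all≤m))

predCost-≤ : ∀ Q → predCost Q ≤ suc (length Q) * 36
predCost-≤ []       = ≤ᵇ⇒≤ 6 36 tt
predCost-≤ (_ ∷ ps) = +-monoʳ-≤ 36 (predCost-≤ ps)

collisionWithCost-≤ : ∀ zs → collisionWithCost zs ≤ suc (length zs) * 23
collisionWithCost-≤ []       = ≤-refl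
collisionWithCost-≤ (_ ∷ zs) = +-mono-≤ (≤ᵇ⇒≤ 19 23 tt) (collisionWithCost-≤ zs)

collisionRate : ℕ → ℕ
collisionRate m = 60 + suc m * 23

collisionCost-≤ : ∀ m ys → length ys ≤ m → collisionCost ys ≤ suc (length ys) * collisionRate m
collisionCost-≤ m []       _ = ≤-trans (≤ᵇ⇒≤ 51 60 tt) (≤-trans (m≤m+n 60 _) (m≤m+n (collisionRate m) 0))
collisionCost-≤ m (_ ∷ zs) |zzs|≤m = begin
  29 + (collisionWithCost zs + (1 + collisionCost zs))
    ≡⟨ cong (29 +_) (+-suc (collisionWithCost zs) (collisionCost zs)) ⟩
  (30 + collisionWithCost zs) + collisionCost zs
    ≤⟨ +-mono-≤ (+-monoʳ-≤ 30 (≤-trans (collisionWithCost-≤ zs) (*-monoˡ-≤ 23 (s≤s |zs|≤m))))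
                (collisionCost-≤ m zs |zs|≤m) ⟩
  (30 + suc m * 23) + suc (length zs) * collisionRate m
    ≤⟨ +-monoˡ-≤ _ (+-monoˡ-≤ (suc m * 23) (≤ᵇ⇒≤ 30 60 tt)) ⟩
  collisionRate m + suc (length zs) * collisionRate m ∎
  where
    open ≤-Reasoning
    |zs|≤m = ≤-trans (n≤1+n _) |zzs|≤m

collisionCost-≤-hole : ∀ {m} ys → 2 + length ys ≤ m → collisionCost ys ≤ suc m * collisionRate m
collisionCost-≤-hole {m} ys |h|≤m = ≤-trans (collisionCost-≤ m ys |ys|≤m) (*-monoˡ-≤ (collisionRate m) (s≤s |ys|≤m))
  where |ys|≤m = ≤-trans (≤-trans (n≤1+n _) (n≤1+n _)) |h|≤m

pigeonholeRate : ℕ → ℕ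
pigeonholeRate m = 15 + (suc (m * m) * 36 + suc m * collisionRate m)

pigeonholeCost-≤ : ∀ m hs → length hs ≤ m → All (λ h → length (vars h) ≤ m) hs →
                   pigeonholeCost hs ≤ suc (length hs) * pigeonholeRate m
pigeonholeCost-≤ m [] _ _ =
  ≤-trans (≤ᵇ⇒≤ 5 15 tt) (≤-trans (m≤m+n 15 _) (m≤m+n (pigeonholeRate m) 0))
pigeonholeCost-≤ m ((_ , _ , ys) ∷ []) _ (|h|≤m ∷ []) = begin
  15 + collisionCost ys                ≤⟨ +-monoʳ-≤ 15 (collisionCost-≤-hole ys |h|≤m) ⟩
  15 + suc m * collisionRate m         ≤⟨ +-monoʳ-≤ 15 (m≤n+m _ (suc (m * m) * 36)) ⟩
  pigeonholeRate m                     ≤⟨ m≤m+n (pigeonholeRate m) _ ⟩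
  2 * pigeonholeRate m                 ∎
  where open ≤-Reasoning
pigeonholeCost-≤ m ((x , y , ys) ∷ h ∷ hs) |hhs|≤m (|h|≤m ∷ all≤m) = begin
  4 + (pigeonholeCost (h ∷ hs) + (6 + (predCost Q + (1 + collisionCost ys))))
    ≡⟨ reassoc (pigeonholeCost (h ∷ hs)) (predCost Q) (collisionCost ys) ⟩
  pigeonholeCost (h ∷ hs) + (11 + (predCost Q + collisionCost ys))
    ≤⟨ +-mono-≤ (pigeonholeCost-≤ m (h ∷ hs) |hs|≤m all≤m)
                (+-monoʳ-≤ 11 (+-mono-≤ (≤-trans (predCost-≤ Q) (*-monoˡ-≤ 36 (s≤s |Q|≤m*m)))
                                        (collisionCost-≤-hole ys |h|≤m))) ⟩
  suc (length (h ∷ hs)) * pigeonholeRate m + (11 + (suc (m * m) * 36 + suc m * collisionRate m))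
    ≤⟨ +-monoʳ-≤ (suc (length (h ∷ hs)) * pigeonholeRate m) (+-monoˡ-≤ _ (≤ᵇ⇒≤ 11 15 tt)) ⟩
  suc (length (h ∷ hs)) * pigeonholeRate m + pigeonholeRate m
    ≡⟨ +-comm _ (pigeonholeRate m) ⟩
  suc (length ((x , y , ys) ∷ h ∷ hs)) * pigeonholeRate m ∎
  where
    open ≤-Reasoning
    Q = concat (map vars (h ∷ hs))
    |hs|≤m = ≤-trans (n≤1+n _) |hhs|≤m
    |Q|≤m*m = ≤-trans (length-concat-vars (h ∷ hs) all≤m) (*-monoˡ-≤ m |hs|≤m)
    reassoc : ∀ a b c → 4 + (a + (6 + (b + (1 + c)))) ≡ a + (11 + (b + c))
    reassoc = solve-∀


length-range : ∀ a b → length (range a b) ≡ suc b ∸ a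
length-range a b = trans (length-map (a +_) (upTo (suc b ∸ a))) (length-upTo (suc b ∸ a))

range-∷ : ∀ {a b} → a ≤ b → range a b ≡ a ∷ range (suc a) b
range-∷ {a} {b} a≤b rewrite +-∸-assoc 1 a≤b = cong₂ _∷_ (+-identityʳ a) shift
  where
    shift : map (a +_) (applyUpTo suc (b ∸ a)) ≡ map (suc a +_) (upTo (b ∸ a))
    shift = begin
      map (a +_) (applyUpTo suc (b ∸ a))   ≡⟨ map-applyUpTo suc (a +_) (b ∸ a) ⟩
      applyUpTo ((a +_) ∘ suc) (b ∸ a)     ≡⟨ applyUpTo-cong (+-suc a) (b ∸ a) ⟩
      applyUpTo (suc a +_) (b ∸ a)         ≡⟨ map-upTo (suc a +_) (b ∸ a) ⟨
      map (suc a +_) (upTo (b ∸ a))        ∎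
      where
        open ≡-Reasoning
        applyUpTo-cong : ∀ {f g : ℕ → ℕ} → (∀ i → f i ≡ g i) → ∀ k → applyUpTo f k ≡ applyUpTo g k
        applyUpTo-cong f≗g zero    = refl
        applyUpTo-cong f≗g (suc k) = cong₂ _∷_ (f≗g 0) (applyUpTo-cong (f≗g ∘ suc) k)

range-empty : ∀ {a b} → b < a → range a b ≡ []
range-empty {a} {b} b<a rewrite m≤n⇒m∸n≡0 b<a = refl

collisionRows-range : ∀ (f : ℕ → ℕ) n d a → a + d ≡ suc n →
  collisionRows (map f (range a (suc n))) ≡
  map (λ i → collisionWith (f i) (map f (range (suc i) (suc n)))) (range a n)
collisionRows-range f n zero a a+0≡1+n with trans (sym (+-identityʳ a)) a+0≡1+n
... | refl = begin
  collisionRows (map f (range (suc n) (suc n)))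
    ≡⟨ cong (collisionRows ∘ map f) (range-∷ (≤-refl {suc n})) ⟩
  collisionRows (f (suc n) ∷ map f (range (suc (suc n)) (suc n)))
    ≡⟨ cong (λ l → collisionRows (f (suc n) ∷ map f l)) (range-empty (≤-refl {suc (suc n)})) ⟩
  []
    ≡⟨ cong (map _) (range-empty (≤-refl {suc n})) ⟨
  map _ (range (suc n) n) ∎
  where open ≡-Reasoning
collisionRows-range f n (suc d) a a+1+d≡1+n = begin
  collisionRows (map f (range a (suc n)))
    ≡⟨ cong (collisionRows ∘ map f) (range-∷ a≤1+n) ⟩
  collisionRows (f a ∷ map f (range (suc a) (suc n)))
    ≡⟨ cong (λ l → collisionRows (f a ∷ map f l)) (range-∷ (s≤s a≤n)) ⟩
  collisionWith (f a) (f (suc a) ∷ map f later) ∷ collisionRows (f (suc a) ∷ map f later)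
    ≡⟨ cong₂ _∷_ (cong (collisionWith (f a) ∘ map f) (sym (range-∷ (s≤s a≤n))))
                 (trans (cong (collisionRows ∘ map f) (sym (range-∷ (s≤s a≤n))))
                        (collisionRows-range f n d (suc a) (trans (sym (+-suc a d)) a+1+d≡1+n))) ⟩
  _ ∷ map _ (range (suc a) n)
    ≡⟨ cong (map _) (range-∷ a≤n) ⟨
  map _ (range a n) ∎
  where
    open ≡-Reasoning
    later = range (suc (suc a)) (suc n)
    a≤n : a ≤ n
    a≤n = ≤-pred (subst (suc a ≤_) (trans (sym (+-suc a d)) a+1+d≡1+n) (s≤s (m≤m+n a d)))
    a≤1+n = m≤n⇒m≤1+n a≤n

formulaBound : ℕ → ℕ
formulaBound m = 6 + collisionsBound m

-- x ≼ (a , k) says x ≤ a · nᵏ; it is a record so that a and k can be inferred from the type.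
module Monomials (n : ℕ) .{{_ : NonZero n}} where

  infix 4 _≼_
  record _≼_ (x : ℕ) (ak : ℕ × ℕ) : Set where
    constructor ≼-intro
    field ≼-elim : x ≤ proj₁ ak * n ^ proj₂ ak
  open _≼_ public

  ≼-const : ∀ a k → a ≼ (a , k)
  ≼-const a k = ≼-intro (≤-trans (≤-reflexive (sym (*-identityʳ a))) (*-monoʳ-≤ a (m^n>0 n k)))

  ≼-n : n ≼ (1 , 1)
  ≼-n = ≼-intro (≤-reflexive (sym (trans (*-identityˡ (n * 1)) (*-identityʳ n))))

  ≼-+ : ∀ {x y a b k} → x ≼ (a , k) → y ≼ (b , k) → x + y ≼ (a + b , k)
  ≼-+ {a = a} {b} {k} (≼-intro x≤) (≼-intro y≤) =
    ≼-intro (≤-trans (+-mono-≤ x≤ y≤) (≤-reflexive (sym (*-distribʳ-+ (n ^ k) a b))))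

  ≼-* : ∀ {x y a b i j} → x ≼ (a , i) → y ≼ (b , j) → x * y ≼ (a * b , i + j)
  ≼-* {x} {y} {a} {b} {i} {j} (≼-intro x≤) (≼-intro y≤) = ≼-intro (begin
    x * y                       ≤⟨ *-mono-≤ x≤ y≤ ⟩
    (a * n ^ i) * (b * n ^ j)   ≡⟨ interchange-* a (n ^ i) b (n ^ j) ⟩
    (a * b) * (n ^ i * n ^ j)   ≡⟨ cong ((a * b) *_) (^-distribˡ-+-* n i j) ⟨
    (a * b) * n ^ (i + j)       ∎)
    where open ≤-Reasoning

  proofSize-≼ : (2 + suc n * pigeonholeRate (suc n)) * (10 * formulaBound (suc n) + 1) ≼ (875666 , 6)
  proofSize-≼ = ≼-* sequents sequentSize
    where
      m : ℕ
      m = suc n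

      ≼-suc : ∀ {x a k} → x ≼ (a , k) → suc x ≼ (1 + a , k)
      ≼-suc = ≼-+ (≼-const 1 _)

      ≼-m : m ≼ (2 , 1)
      ≼-m = ≼-suc ≼-n

      row : rowBound m ≼ (15 , 1)
      row = ≼-suc (≼-* ≼-m (≼-const 7 0))

      hole : holeBound m ≼ (33 , 2)
      hole = ≼-suc (≼-* ≼-m (≼-suc row))

      collisions : collisionsBound m ≼ (69 , 3)
      collisions = ≼-suc (≼-* ≼-m (≼-suc hole))

      sequentSize : 10 * formulaBound m + 1 ≼ (751 , 3)
      sequentSize = ≼-+ (≼-* (≼-const 10 0) (≼-+ (≼-const 6 3) collisions)) (≼-const 1 3)

      rate : collisionRate m ≼ (129 , 1)
      rate = ≼-+ (≼-const 60 1) (≼-* (≼-suc ≼-m) (≼-const 23 0))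

      pigeonRate : pigeonholeRate m ≼ (582 , 2)
      pigeonRate = ≼-+ (≼-const 15 2) (≼-+ (≼-* (≼-suc (≼-* ≼-m ≼-m)) (≼-const 36 0))
                                             (≼-* (≼-suc ≼-m) rate))

      sequents : 2 + m * pigeonholeRate m ≼ (1166 , 3)
      sequents = ≼-+ (≼-const 2 3) (≼-* ≼-m pigeonRate)

-- Opaque, since unfolding c₀ in  n ^ c₀  makes the typechecker expand a power of unary numbers.
opaque
  c₀ : ℕ
  c₀ = 875666

  6≤c₀ : 6 ≤ c₀
  6≤c₀ = ≤ᵇ⇒≤ 6 875666 tt

  875666≤c₀ : 875666 ≤ c₀
  875666≤c₀ = ≤-refl

875666n⁶≤c₀n^c₀ : ∀ n .{{_ : NonZero n}} → 875666 * n ^ 6 ≤ c₀ * n ^ c₀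
875666n⁶≤c₀n^c₀ n = *-mono-≤ 875666≤c₀ (^-monoʳ-≤ n 6≤c₀)

module Columns (n' : ℕ) (v : ℕ → ℕ → ℕ) where

  n : ℕ
  n = suc n'

  column : ℕ → Hole
  column j = v 1 j , v 2 j , map (λ i → v i j) (range 3 (suc n))

  columns : List Hole
  columns = map column (range 1 n)

  length-columns : length columns ≡ n
  length-columns = trans (length-map column (range 1 n)) (length-range 1 n)

  length-column : ∀ j → length (vars (column j)) ≡ suc n
  length-column j = cong (suc ∘ suc) (trans (length-map _ (range 3 (suc n))) (length-range 3 (suc n)))

  vars-column : ∀ j → vars (column j) ≡ map (λ i → v i j) (range 1 (suc n))
  vars-column j = sym (trans (cong (map (λ i → v i j)) (range-∷ (s≤s z≤n)))
                             (cong (λ l → v 1 j ∷ map (λ i → v i j) l) (range-∷ (s≤s (s≤s z≤n)))))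

  map-vars-columns : map vars columns ≡ map (λ j → map (λ i → v i j) (range 1 (suc n))) (range 1 n)
  map-vars-columns = trans (sym (map-∘ (range 1 n))) (map-cong vars-column (range 1 n))

  concat-columns : concat (map vars columns) ≡ Qlist n v
  concat-columns = cong concat map-vars-columns

  anyCollision-columns : anyCollision (map vars columns) ≡ PHPdisj n v
  anyCollision-columns =
    cong ⋁ (trans (cong (map collision) map-vars-columns)
                  (trans (sym (map-∘ (range 1 n))) (map-cong collision-column (range 1 n))))
    where
      collision-column : ∀ j → collision (map (λ i → v i j) (range 1 (suc n))) ≡ _
      collision-column j =
        cong ⋁ (trans (collisionRows-range (λ i → v i j) n n 1 refl)
                      (map-cong (λ i → cong ⋁ (sym (map-∘ (range (suc i) (suc n))))) (range 1 n)))

  m P : ℕ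
  m = suc n
  P = formulaBound m

  private
    growth : ∀ x → x ≤ suc (m * suc x)
    growth x = ≤-trans (n≤1+n x) (≤-trans (m≤m+n (suc x) _) (n≤1+n _))

    holeBound≤P : holeBound m ≤ P
    holeBound≤P = ≤-trans (growth (holeBound m)) (m≤n+m _ 6)

    rowBound≤P : rowBound m ≤ P
    rowBound≤P = ≤-trans (growth (rowBound m)) holeBound≤P

  open Sized P (m≤m+n 6 _)

  private
    small-anyCollision : ∀ hs → length hs ≤ m → All (λ h → length (vars h) ≤ m) hs →
                         Small (anyCollision (map vars hs))
    small-anyCollision hs |hs|≤m all≤m = small (≤-trans (size-anyCollision hs |hs|≤m all≤m) (m≤n+m _ 6))

  open Collisions m
    (λ x ys |ys|≤m → small (≤-trans (size-collisionWith x ys |ys|≤m) rowBound≤P))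
    (λ h |h|≤m → small (≤-trans (size-collision h |h|≤m) holeBound≤P))
    small-anyCollision

  private
    |columns|≤m : length columns ≤ m
    |columns|≤m = ≤-trans (≤-reflexive length-columns) (n≤1+n n)

    all-|column|≤m : All (λ h → length (vars h) ≤ m) columns
    all-|column|≤m = map⁺ (All.universal (λ j → ≤-reflexive (length-column j)) (range 1 n))

  target-derivation : Der (pigeonholeCost columns) (target n v)
  target-derivation =
    subst₂ (λ Q D → Der (pigeonholeCost columns) (ext Q (ℤ.+ suc n) ∷ [] ⊢ D ∷ []))
           concat-columns anyCollision-columns
           (pigeonhole columns n (≤-reflexive length-columns) |columns|≤m all-|column|≤m)

  -- The target has to occur literally in the proof, not only up to reordering, so it is
  -- written once more by a final weakening and contraction.
  target-okProof : OkProof (suc (suc (pigeonholeCost columns))) _∈_ (target n v)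
  target-okProof = flattenThen (wkRᴰ target-derivation (bounded (small-ext ∷ []) (sD ∷ sD ∷ []) tt))
                               (ctrR (∈⇒∈≈ (here refl))) (bounded (small-ext ∷ []) (sD ∷ []) tt)
    where
      sD : Small (PHPdisj n v)
      sD = subst Small anyCollision-columns (small-anyCollision columns |columns|≤m all-|column|≤m)

  target-proof : Σ (List Seq) λ L → IsProof 𝒯 L × (target n v ∈ L) × (proofSize L ≤ c₀ * n ^ c₀)
  target-proof = bound target-okProof
    where
      open ≤-Reasoning
      open Monomials n

      cost≤ : pigeonholeCost columns ≤ m * pigeonholeRate m
      cost≤ = ≤-trans (pigeonholeCost-≤ m columns |columns|≤m all-|column|≤m)
                      (≤-reflexive (cong (λ l → suc l * pigeonholeRate m) length-columns))

      bound : OkProof (suc (suc (pigeonholeCost columns))) _∈_ (target n v) →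
              Σ (List Seq) λ L → IsProof 𝒯 L × (target n v ∈ L) × (proofSize L ≤ c₀ * n ^ c₀)
      bound (L , π , target∈L , |L|≡ , oks) = L , π , target∈L , (begin
        proofSize L                                 ≤⟨ proofSize-≤ (10 * P + 1) L (All.map sizeSeq-≤ oks) ⟩
        length L * (10 * P + 1)                     ≡⟨ cong (_* (10 * P + 1)) |L|≡ ⟩
        (2 + pigeonholeCost columns) * (10 * P + 1) ≤⟨ *-monoˡ-≤ (10 * P + 1) (+-monoʳ-≤ 2 cost≤) ⟩
        (2 + m * pigeonholeRate m) * (10 * P + 1)   ≤⟨ ≼-elim proofSize-≼ ⟩
        875666 * n ^ 6                              ≤⟨ 875666n⁶≤c₀n^c₀ n ⟩
        c₀ * n ^ c₀                                 ∎)

mainTheorem13 : Σ ℕ λ c → ∀ (n : ℕ) → 1 ≤ n → (v : ℕ → ℕ → ℕ) → Distinct n v →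
    Σ (List Seq) λ L → IsProof 𝒯 L × (target n v ∈ L) × (proofSize L ≤ c * n ^ c)
mainTheorem13 = c₀ , λ { zero () ; (suc n') _ v _ → Columns.target-proof n' v }
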